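{- Let $i,j,z\in\mathbb{N}$ and let $Y$ be any Young diagram with $z$ steps. (i) If $z<\binom{i+j}{i}$, then there exists an $(i,j)$-local partition of $Y$ into actual rectangles. (ii) If $z\ge\binom{i+j}{i}$, then there exists no $(i,j)$-local cover of $Y$ by generalized rectangles.
   Context: $\mathbb{N}=\{1,2,\dots\}$ and $[x]=\{1,\dots,x\}$. A Young diagram with $r$ rows and $c$ columns is a set $Y\subseteq [r]\times[c]$ such that whenever $(i,j)\in Y$, then $(i-1,j)\in Y$ if $i\ge 2$ and $(i,j-1)\in Y$ if $j\ge 2$. A generalized rectangle in $Y$ is a set $R=S\times T$ with $S\subseteq[r]$, $T\subseteq[c]$ and $R\subseteq Y$; it uses the rows in $S$ and the columns in $T$. It is an actual rectangle if $S$ and $T$ are each sets of consecutive integers. A cover of $Y$ is a set $C$ of generalized rectangles with $\bigcup_{R\in C}R=Y$; it is a partition if the rectangles in $C$ are pairwise disjoint. A cover is $(i,j)$-local if each row of $Y$ is used by at most $i$ rectangles of $C$ and each column of $Y$ is used by at most $j$ rectangles of $C$. The steps of $Y$ are the cells $(s,t)\in Y$ with $(s+1,t)\notin Y$ and $(s,t+1)\notin Y$. -}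

module Defs where

open import Data.Nat using (ℕ; zero; suc; _≤_)
open import Data.Bool using (Bool; true; false; _∧_; not)
open import Data.List using (List; []; _∷_; length; filter; map; concatMap; upTo)
open import Data.List.Relation.Unary.Any using (Any)
open import Data.List.Relation.Unary.AllPairs using (AllPairs)
open import Data.Product using (_×_; _,_; ∃)
open import Relation.Binary.PropositionalEquality using (_≡_)
open import Relation.Nullary using (¬_)
open import Relation.Nullary.Decidable using (⌊_⌋)
open import Data.Bool.Properties using (T?)
open import Data.Bool using (T)

-- Rows and columns are indexed by ℕ, using 1..r and 1..c (index 0 never used).
-- A subset of ℕ is a Boolean predicate; a cell set is a Boolean predicate on ℕ × ℕ.

record IsYoung (r c : ℕ) (Y : ℕ → ℕ → Bool) : Set where
  field
    inBox    : ∀ s t → Y s t ≡ true → (1 ≤ s × s ≤ r) × (1 ≤ t × t ≤ c)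
    downRow  : ∀ s t → Y (suc (suc s)) t ≡ true → Y (suc s) t ≡ true
    downCol  : ∀ s t → Y s (suc (suc t)) ≡ true → Y s (suc t) ≡ true

record Rect : Set where
  constructor _⊠_
  field
    rows : ℕ → Bool
    cols : ℕ → Bool
open Rect public

_∈R_ : ℕ × ℕ → Rect → Set
(s , t) ∈R R = (rows R s ∧ cols R t) ≡ true

IsGenRect : (r c : ℕ) (Y : ℕ → ℕ → Bool) → Rect → Set
IsGenRect r c Y R =
  (∀ s → rows R s ≡ true → 1 ≤ s × s ≤ r) ×
  (∀ t → cols R t ≡ true → 1 ≤ t × t ≤ c) ×
  (∀ s t → (s , t) ∈R R → Y s t ≡ true)

Consecutive : (ℕ → Bool) → Set
Consecutive S = ∀ x y z → x ≤ y → y ≤ z → S x ≡ true → S z ≡ true → S y ≡ true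

IsActualRect : Rect → Set
IsActualRect R = Consecutive (rows R) × Consecutive (cols R)

IsCover : (r c : ℕ) (Y : ℕ → ℕ → Bool) → List Rect → Set
IsCover r c Y C =
  Data.List.Relation.Unary.All.All (IsGenRect r c Y) C ×
  (∀ s t → Y s t ≡ true → Any (λ R → (s , t) ∈R R) C)
  where import Data.List.Relation.Unary.All

Disjoint : Rect → Rect → Set
Disjoint R R' = ∀ s t → (s , t) ∈R R → ¬ ((s , t) ∈R R')

IsPartition : (r c : ℕ) (Y : ℕ → ℕ → Bool) → List Rect → Set
IsPartition r c Y C = IsCover r c Y C × AllPairs Disjoint C

rowUse : List Rect → ℕ → ℕ
rowUse C s = length (filter (λ R → T? (rows R s)) C)

colUse : List Rect → ℕ → ℕ
colUse C t = length (filter (λ R → T? (cols R t)) C)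

IsLocal : (i j : ℕ) → List Rect → Set
IsLocal i j C = (∀ s → rowUse C s ≤ i) × (∀ t → colUse C t ≤ j)

isStep : (ℕ → ℕ → Bool) → ℕ → ℕ → Bool
isStep Y s t = Y s t ∧ not (Y (suc s) t) ∧ not (Y s (suc t))

cells : ℕ → ℕ → List (ℕ × ℕ)
cells r c = concatMap (λ s → map (λ t → (s , t)) (map suc (upTo c))) (map suc (upTo r))

numSteps : (r c : ℕ) → (ℕ → ℕ → Bool) → ℕ
numSteps r c Y = length (filter (λ p → T? (isStep Y (Data.Product.proj₁ p) (Data.Product.proj₂ p))) (cells r c))

module Submission where

open import Defs
open import Data.Bool using (Bool; true; false; _∧_; _∨_; not; if_then_else_; T)
open import Data.Bool.Properties using (T?; ∧-zeroʳ)
open import Data.Bool.ListAction using (any)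
open import Data.Empty using (⊥; ⊥-elim)
open import Data.List using (List; []; _∷_; [_]; _++_; length; filterᵇ; map; concatMap; upTo; applyUpTo)
open import Data.List.Properties using (length-++; filter-++; map-applyUpTo)
open import Data.List.Membership.Propositional using (_∈_; find)
open import Data.List.Relation.Unary.All as All using (All; []; _∷_)
open import Data.List.Relation.Unary.Any as Any using (Any; here; there)
open import Data.List.Relation.Unary.AllPairs using (AllPairs; []; _∷_)
import Data.List.Relation.Unary.All.Properties as All
import Data.List.Relation.Unary.AllPairs.Properties as AllPairs
import Data.List.Relation.Unary.Any.Properties as Any
open import Data.Nat
  using (ℕ; zero; suc; _+_; _∸_; _⊓_; _≤_; _<_; _≤′_; ≤′-refl; ≤′-step; z≤n; s≤s; _<ᵇ_; _≤ᵇ_; _≤?_; _<?_)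
open import Data.Nat.Properties
open import Data.Nat.Combinatorics using (_C_; nCn≡1; nCk+nC[k+1]≡[n+1]C[k+1])
open import Data.Product using (_×_; _,_; ∃; proj₁; proj₂)
open import Data.Sum using (_⊎_; inj₁; inj₂)
open import Function using (_∘_)
open import Relation.Binary.PropositionalEquality
  using (_≡_; refl; sym; trans; cong; cong₂; subst; subst₂; module ≡-Reasoning)
open import Relation.Nullary using (¬_; Dec; yes; no)

-- Let L(s) be the length of row s, so that the steps are the rows s with L(s+1) < L(s), and let
-- N(i,j) = C(i+j,i) - 1, which satisfies N(i+1,j+1) = N(i,j+1) + N(i+1,j) + 1.
--
-- (i) Tile the cells right of column q in a band of rows containing at most N(i,j) steps (counting
-- only steps right of q). Pick the step row p with min(z-1, N(i-1,j)) of the z steps above it, so that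
-- at most N(i,j-1) lie below it. The corner rectangle (rows from the top of the band to p, columns
-- q+1 .. L(p)) uses each of its rows and columns once; the rows above p right of column L(p) are
-- tiled recursively with one row use less, and the rows below p with one column use less.
--
-- (ii) If the steps are in rows s₁ < ... < s_z, the cell (s_a, L(s_b)) lies in Y exactly when a ≤ b;
-- shifting the column indices by one, these rows and columns form a staircase on z + 1 indices whose
-- cells are the pairs s < t. For a local cover of a staircase on n indices, call m a split if every
-- row before the last of the first m indices lies in a rectangle reaching only columns of the other
-- n - m indices. 1 is a split and n is not, so some split m has m + 1 not a split; then every column
-- after the first of the last n - m indices lies in a rectangle reaching only rows of the first m,
-- since otherwise some rectangle meets the diagonal. Restricting to the first m indices thus saves a
-- row use, restricting to the others saves a column use, and induction gives
-- n ≤ (N(i-1,j) + 1) + (N(i,j-1) + 1) = C(i+j,i).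

∧-elim : ∀ {a b} → (a ∧ b) ≡ true → a ≡ true × b ≡ true
∧-elim {true} {true} refl = refl , refl

∧-intro : ∀ {a b} → a ≡ true → b ≡ true → (a ∧ b) ≡ true
∧-intro refl refl = refl

∧-falseˡ : ∀ {a b} → a ≡ false → (a ∧ b) ≡ false
∧-falseˡ refl = refl

∧-falseʳ : ∀ a {b} → b ≡ false → (a ∧ b) ≡ false
∧-falseʳ a refl = ∧-zeroʳ a

∧-not-false⇒ : ∀ {a b c} → a ≡ true → b ≡ true → (a ∧ (b ∧ not c)) ≡ false → c ≡ true
∧-not-false⇒ {c = true} refl refl _ = refl

not-true : ∀ {a} → not a ≡ true → a ≡ false
not-true {false} refl = refl

true≢false : ∀ {a} → a ≡ true → a ≡ false → ⊥
true≢false refl ()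

¬true⇒false : ∀ {a} → ¬ (a ≡ true) → a ≡ false
¬true⇒false {false} _  = refl
¬true⇒false {true}  ¬t = ⊥-elim (¬t refl)

<⇒<ᵇ≡true : ∀ {m n} → m < n → (m <ᵇ n) ≡ true
<⇒<ᵇ≡true {m} {n} m<n with m <ᵇ n | <⇒<ᵇ m<n
... | true | _ = refl

<ᵇ≡true⇒< : ∀ {m n} → (m <ᵇ n) ≡ true → m < n
<ᵇ≡true⇒< {m} {n} h = <ᵇ⇒< m n (subst T (sym h) _)

≤⇒≤ᵇ≡true : ∀ {m n} → m ≤ n → (m ≤ᵇ n) ≡ true
≤⇒≤ᵇ≡true {m} {n} m≤n with m ≤ᵇ n | ≤⇒≤ᵇ m≤n
... | true | _ = refl

≤ᵇ≡true⇒≤ : ∀ {m n} → (m ≤ᵇ n) ≡ true → m ≤ n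
≤ᵇ≡true⇒≤ {m} {n} h = ≤ᵇ⇒≤ m n (subst T (sym h) _)

any-elim : {A : Set} (p : A → Bool) (xs : List A) → any p xs ≡ true → Any (λ x → p x ≡ true) xs
any-elim p (x ∷ xs) h with p x in px
... | true  = here px
... | false = there (any-elim p xs h)

any-false : {A : Set} (p : A → Bool) (xs : List A) → any p xs ≡ false → All (λ x → p x ≡ false) xs
any-false p []       h = []
any-false p (x ∷ xs) h with p x in px
... | false = px ∷ any-false p xs h

any-none : {A : Set} (p : A → Bool) {xs : List A} → All (λ x → p x ≡ false) xs → any p xs ≡ false
any-none p []         = refl
any-none p (px ∷ pxs) rewrite px = any-none p pxs

count : {A : Set} → (A → Bool) → List A → ℕ
count p = length ∘ filterᵇ p

count-++ : {A : Set} (p : A → Bool) (xs ys : List A) → count p (xs ++ ys) ≡ count p xs + count p ys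
count-++ p xs ys = trans (cong length (filter-++ (T? ∘ p) xs ys)) (length-++ (filterᵇ p xs))

module _ {A : Set} (p : A → Bool) where

  count-accept : ∀ {x} xs → p x ≡ true → count p (x ∷ xs) ≡ suc (count p xs)
  count-accept xs px rewrite px = refl

  count-reject : ∀ {x} xs → p x ≡ false → count p (x ∷ xs) ≡ count p xs
  count-reject xs px rewrite px = refl

  count-∷-≤ : ∀ x xs {k} → (p x ≡ true → count p xs ≤ k) → (p x ≡ false → count p xs ≤ suc k) →
    count p (x ∷ xs) ≤ suc k
  count-∷-≤ x xs used unused with p x
  ... | true  = s≤s (used refl)
  ... | false = unused refl

  count-none : ∀ {xs} → All (λ x → p x ≡ false) xs → count p xs ≡ 0
  count-none []         = refl
  count-none (px ∷ pxs) rewrite px = count-none pxs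

  count-++-noneʳ : ∀ xs {ys} → All (λ y → p y ≡ false) ys → count p (xs ++ ys) ≡ count p xs
  count-++-noneʳ xs {ys} none =
    trans (count-++ p xs ys) (trans (cong (count p xs +_) (count-none none)) (+-identityʳ (count p xs)))

  count-++-noneˡ : ∀ {xs} ys → All (λ x → p x ≡ false) xs → count p (xs ++ ys) ≡ count p ys
  count-++-noneˡ {xs} ys none = trans (count-++ p xs ys) (cong (_+ count p ys) (count-none none))

  count-pos : ∀ {xs} → Any (λ x → p x ≡ true) xs → 0 < count p xs
  count-pos {x ∷ xs} (here px) rewrite px = s≤s z≤n
  count-pos {x ∷ xs} (there any) with p x
  ... | true  = s≤s z≤n
  ... | false = count-pos any

  count-map : {B : Set} (f : B → A) (xs : List B) → count p (map f xs) ≡ count (p ∘ f) xs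
  count-map f [] = refl
  count-map f (x ∷ xs) with p (f x)
  ... | true  = cong suc (count-map f xs)
  ... | false = count-map f xs

  count-concatMap : {B : Set} (d : B → Bool) (f : B → List A) →
    (∀ x → count p (f x) ≡ count d [ x ]) → ∀ xs → count p (concatMap f xs) ≡ count d xs
  count-concatMap d f eq [] = refl
  count-concatMap d f eq (x ∷ xs) = begin
    count p (f x ++ concatMap f xs)           ≡⟨ count-++ p (f x) (concatMap f xs) ⟩
    count p (f x) + count p (concatMap f xs)  ≡⟨ cong₂ _+_ (eq x) (count-concatMap d f eq xs) ⟩
    count d [ x ] + count d xs                ≡⟨ count-++ d [ x ] xs ⟨
    count d (x ∷ xs)                          ∎
    where open ≡-Reasoning

count-cong : {A : Set} (p q : A → Bool) {xs : List A} → All (λ x → p x ≡ q x) xs → count p xs ≡ count q xs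
count-cong p q [] = refl
count-cong p q {x ∷ xs} (px≡qx ∷ eqs) with p x | q x
count-cong p q {x ∷ xs} (refl ∷ eqs) | true  | true  = cong suc (count-cong p q eqs)
count-cong p q {x ∷ xs} (refl ∷ eqs) | false | false = count-cong p q eqs

module _ {A : Set} (p q : A → Bool) (p⇒q : ∀ x → p x ≡ true → q x ≡ true) where

  count-mono : ∀ xs → count p xs ≤ count q xs
  count-mono [] = z≤n
  count-mono (x ∷ xs) with p x in px | q x in qx
  ... | true  | true  = s≤s (count-mono xs)
  ... | true  | false = ⊥-elim (true≢false (p⇒q x px) qx)
  ... | false | true  = m≤n⇒m≤1+n (count-mono xs)
  ... | false | false = count-mono xs

  count-< : ∀ {xs} → Any (λ x → q x ≡ true × p x ≡ false) xs → count p xs < count q xs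
  count-< {x ∷ xs} (here (qx , px)) rewrite qx | px = s≤s (count-mono xs)
  count-< {x ∷ xs} (there any) with p x in px | q x in qx
  ... | true  | true  = s≤s (count-< any)
  ... | true  | false = ⊥-elim (true≢false (p⇒q x px) qx)
  ... | false | true  = m≤n⇒m≤1+n (count-< any)
  ... | false | false = count-< any

range : ℕ → ℕ → List ℕ
range lo zero    = []
range lo (suc n) = lo ∷ range (suc lo) n

range-++ : ∀ lo m n → range lo (m + n) ≡ range lo m ++ range (lo + m) n
range-++ lo zero    n = cong (λ x → range x n) (sym (+-identityʳ lo))
range-++ lo (suc m) n =
  cong (lo ∷_) (trans (range-++ (suc lo) m n) (cong (λ x → range (suc lo) m ++ range x n) (sym (+-suc lo m))))

applyUpTo-range : ∀ (f : ℕ → ℕ) lo n → (∀ k → f k ≡ lo + k) → applyUpTo f n ≡ range lo n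
applyUpTo-range f lo zero    f≗ = refl
applyUpTo-range f lo (suc n) f≗ =
  cong₂ _∷_ (trans (f≗ 0) (+-identityʳ lo))
            (applyUpTo-range (f ∘ suc) (suc lo) n (λ k → trans (f≗ (suc k)) (+-suc lo k)))

map-suc-upTo : ∀ n → map suc (upTo n) ≡ range 1 n
map-suc-upTo n = trans (map-applyUpTo (λ k → k) suc n) (applyUpTo-range suc 1 n (λ _ → refl))

empty-interval : ∀ {lo x} → lo ≤ x → x < lo + 0 → ⊥
empty-interval {lo} lo≤x x<lo = <⇒≱ x<lo (≤-trans (≤-reflexive (+-identityʳ lo)) lo≤x)

All-range : {P : ℕ → Set} → ∀ lo n → (∀ x → lo ≤ x → x < lo + n → P x) → All P (range lo n)
All-range lo zero    h = []
All-range lo (suc n) h =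
  h lo ≤-refl (m<m+n lo (s≤s z≤n)) ∷
  All-range (suc lo) n (λ x lo<x x< → h x (<⇒≤ lo<x) (≤-trans x< (≤-reflexive (sym (+-suc lo n)))))

count-range-unique : (p : ℕ → Bool) → ∀ {lo x} n → lo ≤ x → x < lo + n → p x ≡ true →
  (∀ t → p t ≡ true → t ≡ x) → count p (range lo n) ≡ 1
count-range-unique p zero lo≤x x< _ _ = ⊥-elim (empty-interval lo≤x x<)
count-range-unique p {lo} (suc n) lo≤x x< px unique with m≤n⇒m<n∨m≡n lo≤x
... | inj₂ refl rewrite px = cong suc (count-none p (All-range (suc lo) n (λ t lo<t _ → rejected lo<t)))
  where
  rejected : ∀ {t} → lo < t → p t ≡ false
  rejected {t} lo<t = ¬true⇒false (λ pt → <-irrefl (sym (unique t pt)) lo<t)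
... | inj₁ lo<x = trans (count-reject p (range (suc lo) n) (¬true⇒false (λ pl → <-irrefl (unique lo pl) lo<x)))
  (count-range-unique p n lo<x (≤-trans x< (≤-reflexive (+-suc lo n))) px unique)

anyIn allIn : (ℕ → Bool) → ℕ → ℕ → Bool
anyIn f lo zero    = false
anyIn f lo (suc n) = f lo ∨ anyIn f (suc lo) n
allIn f lo zero    = true
allIn f lo (suc n) = f lo ∧ allIn f (suc lo) n

module _ (f : ℕ → Bool) where

  anyIn-intro : ∀ {lo x} n → lo ≤ x → x < lo + n → f x ≡ true → anyIn f lo n ≡ true
  anyIn-intro zero lo≤x x< fx = ⊥-elim (empty-interval lo≤x x<)
  anyIn-intro {lo} (suc n) lo≤x x< fx with f lo in fl | m≤n⇒m<n∨m≡n lo≤x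
  ... | true  | _         = refl
  ... | false | inj₂ refl = ⊥-elim (true≢false fx fl)
  ... | false | inj₁ lo<x = anyIn-intro n lo<x (≤-trans x< (≤-reflexive (+-suc lo n))) fx

  anyIn-elim : ∀ lo n → anyIn f lo n ≡ true → ∃ λ x → lo ≤ x × x < lo + n × f x ≡ true
  anyIn-elim lo (suc n) h with f lo in fl
  ... | true  = lo , ≤-refl , m<m+n lo (s≤s z≤n) , fl
  ... | false with anyIn-elim (suc lo) n h
  ...   | x , lo<x , x< , fx = x , <⇒≤ lo<x , ≤-trans x< (≤-reflexive (sym (+-suc lo n))) , fx

  anyIn-sub : ∀ lo′ n′ lo n → lo ≤ lo′ → lo′ + n′ ≤ lo + n →
    anyIn f lo′ n′ ≡ true → anyIn f lo n ≡ true
  anyIn-sub lo′ n′ lo n lo≤lo′ hi′≤hi h with anyIn-elim lo′ n′ h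
  ... | x , lo′≤x , x< , fx = anyIn-intro n (≤-trans lo≤lo′ lo′≤x) (≤-trans x< hi′≤hi) fx

  allIn-elim : ∀ {lo x} n → allIn f lo n ≡ true → lo ≤ x → x < lo + n → f x ≡ true
  allIn-elim zero h lo≤x x< = ⊥-elim (empty-interval lo≤x x<)
  allIn-elim {lo} (suc n) h lo≤x x< with f lo in fl | m≤n⇒m<n∨m≡n lo≤x
  ... | true  | inj₂ refl = fl
  ... | true  | inj₁ lo<x = allIn-elim n h lo<x (≤-trans x< (≤-reflexive (+-suc lo n)))

  allIn-false : ∀ lo n → allIn f lo n ≡ false → ∃ λ x → lo ≤ x × x < lo + n × f x ≡ false
  allIn-false lo (suc n) h with f lo in fl
  ... | false = lo , ≤-refl , m<m+n lo (s≤s z≤n) , fl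
  ... | true with allIn-false (suc lo) n h
  ...   | x , lo<x , x< , fx = x , <⇒≤ lo<x , ≤-trans x< (≤-reflexive (sym (+-suc lo n))) , fx

crossing : (p : ℕ → Bool) → ∀ x k → p x ≡ true → p (x + k) ≡ false →
  ∃ λ m → x ≤ m × m < x + k × p m ≡ true × p (suc m) ≡ false
crossing p x zero px pxk = ⊥-elim (true≢false px (subst (λ y → p y ≡ false) (+-identityʳ x) pxk))
crossing p x (suc k) px pxk with p (suc x) in psx
... | false = x , ≤-refl , m<m+n x (s≤s z≤n) , px , psx
... | true with crossing p (suc x) k psx (subst (λ y → p y ≡ false) (+-suc x k) pxk)
...   | m , x<m , m< , pm , psm = m , <⇒≤ x<m , ≤-trans m< (≤-reflexive (sym (+-suc x k))) , pm , psm

maxSteps : ℕ → ℕ → ℕ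
maxSteps zero    j       = 0
maxSteps (suc i) zero    = 0
maxSteps (suc i) (suc j) = suc (maxSteps i (suc j) + maxSteps (suc i) j)

suc-maxSteps : ∀ i j → suc (maxSteps i j) ≡ (i + j) C i
suc-maxSteps zero    j       = refl
suc-maxSteps (suc i) zero    = sym (trans (cong (_C suc i) (+-identityʳ (suc i))) (nCn≡1 (suc i)))
suc-maxSteps (suc i) (suc j) = begin
  suc (suc (maxSteps i (suc j) + maxSteps (suc i) j))   ≡⟨ cong suc (+-suc (maxSteps i (suc j)) _) ⟨
  suc (maxSteps i (suc j)) + suc (maxSteps (suc i) j)   ≡⟨ cong₂ _+_ (suc-maxSteps i (suc j)) (suc-maxSteps (suc i) j) ⟩
  (i + suc j) C i + (suc i + j) C suc i                 ≡⟨ cong (λ n → (i + suc j) C i + n C suc i) (+-suc i j) ⟨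
  (i + suc j) C i + (i + suc j) C suc i                 ≡⟨ nCk+nC[k+1]≡[n+1]C[k+1] (i + suc j) i ⟩
  suc (i + suc j) C suc i                               ∎
  where open ≡-Reasoning

-- Staircases

-- Index s of the staircase stands for row ρ s and index t for column κ t of the grid; the cells of the
-- staircase on [lo, lo + n) are the pairs s < t of indices in that interval.
module Staircase (rects : List Rect) (ρ κ : ℕ → ℕ)
  (above-diagonal : All (λ R → ∀ s t → (rows R (ρ s) ∧ cols R (κ t)) ≡ true → s < t) rects) where

  usesRow usesCol : Rect → ℕ → Bool
  usesRow R s = rows R (ρ s)
  usesCol R t = cols R (κ t)

  rowMeets colMeets : ℕ → ℕ → ℕ → Rect → Bool
  rowMeets lo n s R = usesRow R s ∧ anyIn (usesCol R) lo n
  colMeets lo n t R = usesCol R t ∧ anyIn (usesRow R) lo n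

  rowUseIn colUseIn : ℕ → ℕ → ℕ → ℕ
  rowUseIn lo n s = count (rowMeets lo n s) rects
  colUseIn lo n t = count (colMeets lo n t) rects

  -- Only rows and columns containing a cell of the staircase are constrained.
  record LocalCover (i j lo n : ℕ) : Set where
    field
      covers    : ∀ s t → lo ≤ s → s < t → t < lo + n →
                  Any (λ R → (usesRow R s ∧ usesCol R t) ≡ true) rects
      row-local : ∀ s → lo ≤ s → suc s < lo + n → rowUseIn lo n s ≤ i
      col-local : ∀ t → lo < t → t < lo + n → colUseIn lo n t ≤ j
  open LocalCover

  rowExitsRight colExitsLeft : ℕ → ℕ → ℕ → ℕ → Rect → Bool
  rowExitsRight lo n m s R =
    usesRow R s ∧ (anyIn (usesCol R) (lo + m) (n ∸ m) ∧ not (anyIn (usesCol R) lo m))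
  colExitsLeft lo n m t R =
    usesCol R t ∧ (anyIn (usesRow R) lo m ∧ not (anyIn (usesRow R) (lo + m) (n ∸ m)))

  leftSplit rightSplit : ℕ → ℕ → ℕ → Bool
  leftSplit  lo n m = allIn (λ s → any (rowExitsRight lo n m s) rects) lo (m ∸ 1)
  rightSplit lo n m = allIn (λ t → any (colExitsLeft lo n m t) rects) (suc (lo + m)) (n ∸ suc m)

  split-end : ∀ lo {m n} → m ≤ n → lo + m + (n ∸ m) ≡ lo + n
  split-end lo {m} {n} m≤n = trans (+-assoc lo m (n ∸ m)) (cong (lo +_) (m+[n∸m]≡n m≤n))

  split-end′ : ∀ lo {m n} → m < n → suc (lo + m) + (n ∸ suc m) ≡ lo + n
  split-end′ lo {m} {n} m<n = trans (cong (_+ (n ∸ suc m)) (sym (+-suc lo m))) (split-end lo m<n)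

  stuck-rectangle-impossible : ∀ {lo n m s t} R → (∀ s t → (usesRow R s ∧ usesCol R t) ≡ true → s < t) →
    m < n → lo ≤ s → s < lo + m → lo + m < t → t < lo + n →
    rowExitsRight lo n (suc m) s R ≡ false → colExitsLeft lo n m t R ≡ false →
    (usesRow R s ∧ usesCol R t) ≡ true → ⊥
  stuck-rectangle-impossible {lo} {n} {m} {s} {t} R above m<n lo≤s s< lo+m<t t< s-stays t-stays R-st
    with ∧-elim R-st
  ... | Rs , Rt
    with anyIn-elim (usesCol R) lo (suc m) cols-meet-left | anyIn-elim (usesRow R) (lo + m) (n ∸ m) rows-meet-right
    where
    t-right : t < lo + suc m + (n ∸ suc m)
    t-right = ≤-trans t< (≤-reflexive (sym (split-end lo m<n)))
    cols-meet-left : anyIn (usesCol R) lo (suc m) ≡ true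
    cols-meet-left =
      ∧-not-false⇒ Rs (anyIn-intro (usesCol R) (n ∸ suc m) (≤-trans (≤-reflexive (+-suc lo m)) lo+m<t) t-right Rt)
        s-stays
    rows-meet-right : anyIn (usesRow R) (lo + m) (n ∸ m) ≡ true
    rows-meet-right = ∧-not-false⇒ Rt (anyIn-intro (usesRow R) m lo≤s s< Rs) t-stays
  ... | t′ , _ , t′< , Rt′ | s′ , lo+m≤s′ , _ , Rs′ =
    <⇒≱ (above s′ t′ (∧-intro Rs′ Rt′))
        (≤-trans (≤-pred (≤-trans t′< (≤-reflexive (+-suc lo m)))) lo+m≤s′)

  ¬leftSplit⇒rightSplit : ∀ {i j lo n m} → LocalCover i j lo n → m < n →
    leftSplit lo n (suc m) ≡ false → rightSplit lo n m ≡ true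
  ¬leftSplit⇒rightSplit {lo = lo} {n} {m} cover m<n ¬left with rightSplit lo n m in ¬right
  ... | true  = refl
  ... | false with allIn-false _ _ _ ¬right | allIn-false _ _ _ ¬left
  ...   | t , lo+m<t , t< , t-stays | s , lo≤s , s< , s-stays =
    ⊥-elim (impossible (find (covers cover s t lo≤s (<-≤-trans s< (<⇒≤ lo+m<t)) t<n)))
    where
    t<n : t < lo + n
    t<n = ≤-trans t< (≤-reflexive (split-end′ lo m<n))
    impossible : (∃ λ R → R ∈ rects × (usesRow R s ∧ usesCol R t) ≡ true) → ⊥
    impossible (R , R∈ , R-st) =
      stuck-rectangle-impossible R (All.lookup above-diagonal R∈) m<n lo≤s s< lo+m<t t<n
        (All.lookup (any-false (rowExitsRight lo n (suc m) s) rects s-stays) R∈)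
        (All.lookup (any-false (colExitsLeft lo n m t) rects t-stays) R∈) R-st

  module _ (lo′ n′ lo n : ℕ) (lo≤lo′ : lo ≤ lo′) (hi′≤hi : lo′ + n′ ≤ lo + n) where

    rowMeets-mono : ∀ s R → rowMeets lo′ n′ s R ≡ true → rowMeets lo n s R ≡ true
    rowMeets-mono s R h = let Rs , meets = ∧-elim h in
      ∧-intro Rs (anyIn-sub (usesCol R) lo′ n′ lo n lo≤lo′ hi′≤hi meets)

    colMeets-mono : ∀ t R → colMeets lo′ n′ t R ≡ true → colMeets lo n t R ≡ true
    colMeets-mono t R h = let Rt , meets = ∧-elim h in
      ∧-intro Rt (anyIn-sub (usesRow R) lo′ n′ lo n lo≤lo′ hi′≤hi meets)

    rowUseIn-mono : ∀ s → rowUseIn lo′ n′ s ≤ rowUseIn lo n s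
    rowUseIn-mono s = count-mono (rowMeets lo′ n′ s) (rowMeets lo n s) (rowMeets-mono s) rects

    colUseIn-mono : ∀ t → colUseIn lo′ n′ t ≤ colUseIn lo n t
    colUseIn-mono t = count-mono (colMeets lo′ n′ t) (colMeets lo n t) (colMeets-mono t) rects

  rowUseIn-< : ∀ {lo n m} s → m ≤ n → any (rowExitsRight lo n m s) rects ≡ true →
    rowUseIn lo m s < rowUseIn lo n s
  rowUseIn-< {lo} {n} {m} s m≤n exits =
    count-< (rowMeets lo m s) (rowMeets lo n s) (rowMeets-mono lo m lo n ≤-refl (+-monoʳ-≤ lo m≤n) s)
      (Any.map (λ {R} → escapes R) (any-elim (rowExitsRight lo n m s) rects exits))
    where
    escapes : ∀ R → rowExitsRight lo n m s R ≡ true → rowMeets lo n s R ≡ true × rowMeets lo m s R ≡ false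
    escapes R h with ∧-elim h
    ... | Rs , right with ∧-elim right
    ...   | meets-right , ¬meets-left =
      ∧-intro Rs (anyIn-sub (usesCol R) (lo + m) (n ∸ m) lo n (m≤m+n lo m) (≤-reflexive (split-end lo m≤n))
                            meets-right) ,
      ∧-falseʳ (usesRow R s) (not-true ¬meets-left)

  colUseIn-< : ∀ {lo n m} t → m ≤ n → any (colExitsLeft lo n m t) rects ≡ true →
    colUseIn (lo + m) (n ∸ m) t < colUseIn lo n t
  colUseIn-< {lo} {n} {m} t m≤n exits =
    count-< (colMeets (lo + m) (n ∸ m) t) (colMeets lo n t)
      (colMeets-mono (lo + m) (n ∸ m) lo n (m≤m+n lo m) (≤-reflexive (split-end lo m≤n)) t)
      (Any.map (λ {R} → escapes R) (any-elim (colExitsLeft lo n m t) rects exits))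
    where
    escapes : ∀ R → colExitsLeft lo n m t R ≡ true →
      colMeets lo n t R ≡ true × colMeets (lo + m) (n ∸ m) t R ≡ false
    escapes R h with ∧-elim {usesCol R t} h
    ... | Rt , left with ∧-elim {anyIn (usesRow R) lo m} left
    ...   | meets-left , ¬meets-right =
      ∧-intro Rt (anyIn-sub (usesRow R) lo m lo n ≤-refl (+-monoʳ-≤ lo m≤n) meets-left) ,
      ∧-falseʳ (usesCol R t) (not-true ¬meets-right)

  left-block : ∀ {i j lo n m} → LocalCover (suc i) j lo n → suc m ≤ n → leftSplit lo n (suc m) ≡ true →
    LocalCover i j lo (suc m)
  left-block {i} {j} {lo} {n} {m} cover m<n split = record
    { covers    = λ s t lo≤s s<t t< → covers cover s t lo≤s s<t (≤-trans t< inside)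
    ; row-local = λ s lo≤s s+1< → ≤-pred (≤-trans
        (rowUseIn-< s m<n (allIn-elim _ m split lo≤s (≤-pred (≤-trans s+1< (≤-reflexive (+-suc lo m))))))
        (row-local cover s lo≤s (≤-trans s+1< inside)))
    ; col-local = λ t lo<t t< → ≤-trans (colUseIn-mono lo (suc m) lo n ≤-refl inside t)
        (col-local cover t lo<t (≤-trans t< inside))
    }
    where
    inside : lo + suc m ≤ lo + n
    inside = +-monoʳ-≤ lo m<n

  right-block : ∀ {i j lo n m} → LocalCover i (suc j) lo n → m < n → rightSplit lo n m ≡ true →
    LocalCover i j (lo + m) (n ∸ m)
  right-block {i} {j} {lo} {n} {m} cover m<n split = record
    { covers    = λ s t lo+m≤s s<t t< → covers cover s t (≤-trans (m≤m+n lo m) lo+m≤s) s<t (≤-trans t< inside)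
    ; row-local = λ s lo+m≤s s+1< → ≤-trans (rowUseIn-mono (lo + m) (n ∸ m) lo n (m≤m+n lo m) inside s)
        (row-local cover s (≤-trans (m≤m+n lo m) lo+m≤s) (≤-trans s+1< inside))
    ; col-local = λ t lo+m<t t< → ≤-pred (≤-trans
        (colUseIn-< t (<⇒≤ m<n) (allIn-elim _ (n ∸ suc m) split lo+m<t
          (≤-trans t< (≤-reflexive (trans (split-end lo (<⇒≤ m<n)) (sym (split-end′ lo m<n)))))))
        (col-local cover t (≤-trans (s≤s (m≤m+n lo m)) lo+m<t) (≤-trans t< inside)))
    }
    where
    inside : lo + m + (n ∸ m) ≤ lo + n
    inside = ≤-reflexive (split-end lo (<⇒≤ m<n))

  leftSplit-whole : ∀ lo n → leftSplit lo (suc (suc n)) (suc (suc n)) ≡ false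
  leftSplit-whole lo n =
    ∧-falseˡ (any-none (rowExitsRight lo (suc (suc n)) (suc (suc n)) lo) (All.universal no-right-part rects))
    where
    no-right-part : ∀ R → rowExitsRight lo (suc (suc n)) (suc (suc n)) lo R ≡ false
    no-right-part R rewrite n∸n≡0 n = ∧-zeroʳ (usesRow R lo)

  second-index : ∀ lo n → suc lo < lo + suc (suc n)
  second-index lo n =
    ≤-trans (s≤s (s≤s (m≤m+n lo n))) (≤-reflexive (sym (trans (+-suc lo (suc n)) (cong suc (+-suc lo n)))))

  first-cell-covered : ∀ {i j lo n} → LocalCover i j lo (suc (suc n)) →
    Any (λ R → (usesRow R lo ∧ usesCol R (suc lo)) ≡ true) rects
  first-cell-covered {lo = lo} {n} cover = covers cover lo (suc lo) ≤-refl ≤-refl (second-index lo n)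

  first-row-used : ∀ {i j lo n} → LocalCover i j lo (suc (suc n)) → 0 < rowUseIn lo (suc (suc n)) lo
  first-row-used {lo = lo} {n} cover =
    count-pos (rowMeets lo (suc (suc n)) lo) (Any.map (λ {R} → meets R) (first-cell-covered cover))
    where
    meets : ∀ R → (usesRow R lo ∧ usesCol R (suc lo)) ≡ true → rowMeets lo (suc (suc n)) lo R ≡ true
    meets R h = let Rs , Rt = ∧-elim h in
      ∧-intro Rs (anyIn-intro (usesCol R) (suc (suc n)) (n≤1+n lo) (second-index lo n) Rt)

  second-col-used : ∀ {i j lo n} → LocalCover i j lo (suc (suc n)) → 0 < colUseIn lo (suc (suc n)) (suc lo)
  second-col-used {lo = lo} {n} cover =
    count-pos (colMeets lo (suc (suc n)) (suc lo)) (Any.map (λ {R} → meets R) (first-cell-covered cover))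
    where
    meets : ∀ R → (usesRow R lo ∧ usesCol R (suc lo)) ≡ true → colMeets lo (suc (suc n)) (suc lo) R ≡ true
    meets R h = let Rs , Rt = ∧-elim h in
      ∧-intro Rt (anyIn-intro (usesRow R) (suc (suc n)) ≤-refl (<-trans (n<1+n lo) (second-index lo n)) Rs)

  staircase-bound : ∀ i j lo n → LocalCover i j lo n → n ≤ suc (maxSteps i j)
  staircase-bound i j lo zero          cover = z≤n
  staircase-bound i j lo (suc zero)    cover = s≤s z≤n
  staircase-bound zero j lo (suc (suc n)) cover =
    ⊥-elim (<⇒≱ (first-row-used cover) (row-local cover lo ≤-refl (second-index lo n)))
  staircase-bound (suc i) zero lo (suc (suc n)) cover =
    ⊥-elim (<⇒≱ (second-col-used cover) (col-local cover (suc lo) ≤-refl (second-index lo n)))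
  staircase-bound (suc i) (suc j) lo (suc (suc n)) cover
    with crossing (leftSplit lo (suc (suc n))) 1 (suc n) refl (leftSplit-whole lo n)
  ... | suc m , _ , m<N , left , ¬left′ = begin
    N                                                     ≡⟨ m+[n∸m]≡n (<⇒≤ m<N) ⟨
    suc m + (N ∸ suc m)                                   ≤⟨ +-mono-≤ left-bound right-bound ⟩
    suc (maxSteps i (suc j)) + suc (maxSteps (suc i) j)   ≡⟨ cong suc (+-suc (maxSteps i (suc j)) _) ⟩
    suc (maxSteps (suc i) (suc j))                        ∎
    where
    N = suc (suc n)
    left-bound : suc m ≤ suc (maxSteps i (suc j))
    left-bound = staircase-bound i (suc j) lo (suc m) (left-block cover (<⇒≤ m<N) left)
    right-bound : N ∸ suc m ≤ suc (maxSteps (suc i) j)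
    right-bound = staircase-bound (suc i) j (lo + suc m) (N ∸ suc m)
      (right-block cover m<N (¬leftSplit⇒rightSplit cover m<N ¬left′))
    open ≤-Reasoning

-- Row lengths and steps of a Young diagram

module Young {r c : ℕ} {Y : ℕ → ℕ → Bool} (young : IsYoung r c Y) where
  open IsYoung young

  left-closed : ∀ s {t u} → 1 ≤ t → t ≤ u → Y s u ≡ true → Y s t ≡ true
  left-closed s {t} 1≤t t≤u = leftwards (≤⇒≤′ t≤u)
    where
    leftwards : ∀ {u} → t ≤′ u → Y s u ≡ true → Y s t ≡ true
    leftwards ≤′-refl                 Ysu = Ysu
    leftwards (≤′-step {zero}  t≤′0)  _   = ⊥-elim (<⇒≱ 1≤t (≤′⇒≤ t≤′0))
    leftwards (≤′-step {suc u} t≤′u)  Ysu = leftwards t≤′u (downCol s u Ysu)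

  up-closed : ∀ {s u} t → 1 ≤ s → s ≤ u → Y u t ≡ true → Y s t ≡ true
  up-closed {s} t 1≤s s≤u = upwards (≤⇒≤′ s≤u)
    where
    upwards : ∀ {u} → s ≤′ u → Y u t ≡ true → Y s t ≡ true
    upwards ≤′-refl                 Yut = Yut
    upwards (≤′-step {zero}  s≤′0)  _   = ⊥-elim (<⇒≱ 1≤s (≤′⇒≤ s≤′0))
    upwards (≤′-step {suc u} s≤′u)  Yut = upwards s≤′u (downRow u t Yut)

  lastCellUpTo : ℕ → ℕ → ℕ
  lastCellUpTo s zero    = 0
  lastCellUpTo s (suc k) = if Y s (suc k) then suc k else lastCellUpTo s k

  rowLength : ℕ → ℕ
  rowLength s = lastCellUpTo s c

  lastCellUpTo-≤ : ∀ s k → lastCellUpTo s k ≤ k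
  lastCellUpTo-≤ s zero = z≤n
  lastCellUpTo-≤ s (suc k) with Y s (suc k)
  ... | true  = ≤-refl
  ... | false = m≤n⇒m≤1+n (lastCellUpTo-≤ s k)

  lastCellUpTo-≥ : ∀ s k {t} → Y s t ≡ true → t ≤ k → t ≤ lastCellUpTo s k
  lastCellUpTo-≥ s zero    _   z≤n = z≤n
  lastCellUpTo-≥ s (suc k) Yst t≤k with Y s (suc k) in Ysk | m≤n⇒m<n∨m≡n t≤k
  ... | true  | _          = t≤k
  ... | false | inj₁ t<1+k = lastCellUpTo-≥ s k Yst (≤-pred t<1+k)
  ... | false | inj₂ refl  = ⊥-elim (true≢false Yst Ysk)

  lastCellUpTo-cell : ∀ s k {t} → 1 ≤ t → t ≤ lastCellUpTo s k → Y s t ≡ true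
  lastCellUpTo-cell s zero (s≤s z≤n) ()
  lastCellUpTo-cell s (suc k) 1≤t t≤ with Y s (suc k) in Ysk
  ... | true  = left-closed s 1≤t t≤ Ysk
  ... | false = lastCellUpTo-cell s k 1≤t t≤

  rowLength≤c : ∀ s → rowLength s ≤ c
  rowLength≤c s = lastCellUpTo-≤ s c

  cell⇒≤rowLength : ∀ {s t} → Y s t ≡ true → 1 ≤ t × t ≤ rowLength s
  cell⇒≤rowLength {s} {t} Yst = let _ , 1≤t , t≤c = inBox s t Yst in
    1≤t , lastCellUpTo-≥ s c Yst t≤c

  ≤rowLength⇒cell : ∀ {s t} → 1 ≤ t → t ≤ rowLength s → Y s t ≡ true
  ≤rowLength⇒cell = lastCellUpTo-cell _ c

  rowLength<⇒¬cell : ∀ {s t} → rowLength s < t → Y s t ≡ false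
  rowLength<⇒¬cell {s} {t} len<t = ¬true⇒false λ Yst → <⇒≱ len<t (proj₂ (cell⇒≤rowLength Yst))

  rowLength-antitone : ∀ {s s′} → 1 ≤ s → s ≤ s′ → rowLength s′ ≤ rowLength s
  rowLength-antitone {s} {s′} 1≤s s≤s′ with rowLength s′ in len
  ... | zero  = z≤n
  ... | suc l =
    lastCellUpTo-≥ s c (up-closed (suc l) 1≤s s≤s′ (≤rowLength⇒cell (s≤s z≤n) (≤-reflexive (sym len))))
                       (≤-trans (≤-reflexive (sym len)) (rowLength≤c s′))

  rowLength-beyond : ∀ {s} → r < s → rowLength s ≡ 0
  rowLength-beyond {s} r<s with rowLength s in len
  ... | zero  = refl
  ... | suc l =
    ⊥-elim (<⇒≱ r<s (proj₂ (proj₁ (inBox s 1 (≤rowLength⇒cell ≤-refl (≤-trans (s≤s z≤n) (≤-reflexive (sym len))))))))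

  stepBeyond : ℕ → ℕ → Bool
  stepBeyond q s = (q <ᵇ rowLength s) ∧ (rowLength (suc s) <ᵇ rowLength s)

  stepBeyond-intro : ∀ {q s} → q < rowLength s → rowLength (suc s) < rowLength s → stepBeyond q s ≡ true
  stepBeyond-intro q<len drop = ∧-intro (<⇒<ᵇ≡true q<len) (<⇒<ᵇ≡true drop)

  stepBeyond-elim : ∀ {q s} → stepBeyond q s ≡ true → q < rowLength s × rowLength (suc s) < rowLength s
  stepBeyond-elim {q} {s} step = let q<len , drop = ∧-elim {q <ᵇ rowLength s} step in
    <ᵇ≡true⇒< q<len , <ᵇ≡true⇒< drop

  step-at-rowLength : ∀ {s t} → isStep Y s t ≡ true → t ≡ rowLength s
  step-at-rowLength {s} {t} step with ∧-elim {Y s t} step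
  ... | Yst , outside with ∧-elim {not (Y (suc s) t)} outside
  ...   | _ , ¬right = ≤-antisym (proj₂ (cell⇒≤rowLength Yst))
                        (≮⇒≥ λ t<len → true≢false (≤rowLength⇒cell (s≤s z≤n) t<len) (not-true ¬right))

  step⇒stepBeyond : ∀ {s t} → isStep Y s t ≡ true → stepBeyond 0 s ≡ true
  step⇒stepBeyond {s} {t} step with ∧-elim {Y s t} step | step-at-rowLength step
  ... | Yst , outside | refl =
    stepBeyond-intro 0<t (≰⇒> λ t≤below → true≢false (≤rowLength⇒cell 0<t t≤below) (not-true (proj₁ (∧-elim outside))))
    where
    0<t = proj₁ (cell⇒≤rowLength Yst)

  steps-in-row : ∀ s → count (isStep Y s) (range 1 c) ≡ count (stepBeyond 0) [ s ]
  steps-in-row s with stepBeyond 0 s in corner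
  ... | true = count-range-unique (isStep Y s) c 0<len (s≤s (rowLength≤c s)) step (λ _ → step-at-rowLength)
    where
    0<len = proj₁ (stepBeyond-elim corner)
    step : isStep Y s (rowLength s) ≡ true
    step rewrite ≤rowLength⇒cell {s} 0<len ≤-refl
               | rowLength<⇒¬cell (proj₂ (stepBeyond-elim corner))
               | rowLength<⇒¬cell {s} ≤-refl = refl
  ... | false = count-none (isStep Y s)
    (All-range 1 c λ t _ _ → ¬true⇒false λ step → true≢false (step⇒stepBeyond step) corner)

  numSteps≡count-stepBeyond : numSteps r c Y ≡ count (stepBeyond 0) (range 1 r)
  numSteps≡count-stepBeyond = begin
    count isStepAt (concatMap (λ s → map (s ,_) (map suc (upTo c))) (map suc (upTo r)))
      ≡⟨ cong₂ (λ cs rs → count isStepAt (concatMap (λ s → map (s ,_) cs) rs)) (map-suc-upTo c) (map-suc-upTo r) ⟩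
    count isStepAt (concatMap (λ s → map (s ,_) (range 1 c)) (range 1 r))
      ≡⟨ count-concatMap isStepAt (stepBeyond 0) (λ s → map (s ,_) (range 1 c))
           (λ s → trans (count-map isStepAt (s ,_) (range 1 c)) (steps-in-row s)) (range 1 r) ⟩
    count (stepBeyond 0) (range 1 r) ∎
    where
    isStepAt : ℕ × ℕ → Bool
    isStepAt (s , t) = isStep Y s t
    open ≡-Reasoning

  stepsBeyond : ℕ → ℕ → ℕ → ℕ
  stepsBeyond q a n = count (stepBeyond q) (range a n)

  stepsBeyond-++ : ∀ q a m n → stepsBeyond q a (m + n) ≡ stepsBeyond q a m + stepsBeyond q (a + m) n
  stepsBeyond-++ q a m n =
    trans (cong (count (stepBeyond q)) (range-++ a m n)) (count-++ (stepBeyond q) (range a m) (range (a + m) n))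

  stepsBeyond-mono : ∀ q a {m n} → m ≤ n → stepsBeyond q a m ≤ stepsBeyond q a n
  stepsBeyond-mono q a {m} {n} m≤n = subst (stepsBeyond q a m ≤_)
    (trans (sym (stepsBeyond-++ q a m (n ∸ m))) (cong (stepsBeyond q a) (m+[n∸m]≡n m≤n))) (m≤m+n _ _)

  stepsBeyond-around : ∀ q a m rest → stepBeyond q (a + m) ≡ true →
    stepsBeyond q a (m + suc rest) ≡ stepsBeyond q a m + suc (stepsBeyond q (suc (a + m)) rest)
  stepsBeyond-around q a m rest step = trans (stepsBeyond-++ q a m (suc rest))
    (cong (stepsBeyond q a m +_) (count-accept (stepBeyond q) (range (suc (a + m)) rest) step))

  kth-step : ∀ q a n k → k < stepsBeyond q a n →
    ∃ λ m → m < n × stepBeyond q (a + m) ≡ true × stepsBeyond q a m ≡ k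
  kth-step q a (suc n) k k< with stepBeyond q a in step
  kth-step q a (suc n) zero _ | true = 0 , s≤s z≤n , trans (cong (stepBeyond q) (+-identityʳ a)) step , refl
  kth-step q a (suc n) (suc k) (s≤s k<) | true with kth-step q (suc a) n k k<
  ... | m , m<n , step′ , rank = suc m , s≤s m<n , trans (cong (stepBeyond q) (+-suc a m)) step′ ,
                                 trans (count-accept (stepBeyond q) (range (suc a) m) step) (cong suc rank)
  kth-step q a (suc n) k k< | false with kth-step q (suc a) n k k<
  ... | m , m<n , step′ , rank = suc m , s≤s m<n , trans (cong (stepBeyond q) (+-suc a m)) step′ ,
                                 trans (count-reject (stepBeyond q) (range (suc a) m) step) rank

  no-steps⇒short : ∀ q a n → stepsBeyond q a n ≡ 0 → rowLength (a + n) ≤ q →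
    ∀ {s} → a ≤ s → s ≤ a + n → rowLength s ≤ q
  no-steps⇒short q a zero _ last {s} a≤s s≤ =
    subst (λ x → rowLength x ≤ q) (≤-antisym (≤-trans (≤-reflexive (+-identityʳ a)) a≤s) s≤) last
  no-steps⇒short q a (suc n) none last a≤s s≤ with stepBeyond q a in step
  ... | false with no-steps⇒short q (suc a) n none (subst (λ x → rowLength x ≤ q) (+-suc a n) last)
                 | m≤n⇒m<n∨m≡n a≤s
  ...   | below | inj₁ a<s  = below a<s (≤-trans s≤ (≤-reflexive (+-suc a n)))
  ...   | below | inj₂ refl =
    ≮⇒≥ λ q<len → true≢false (stepBeyond-intro q<len (≤-<-trans (below ≤-refl (s≤s (m≤m+n a n))) q<len)) step

  stepBeyond-raise : ∀ {q q′} s → q ≤ q′ → q′ ≤ rowLength (suc s) → stepBeyond q′ s ≡ stepBeyond q s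
  stepBeyond-raise {q} {q′} s q≤q′ q′≤len with rowLength (suc s) <ᵇ rowLength s in drop
  ... | false = trans (∧-zeroʳ (q′ <ᵇ rowLength s)) (sym (∧-zeroʳ (q <ᵇ rowLength s)))
  ... | true  = cong (_∧ true) (trans (<⇒<ᵇ≡true q′<len) (sym (<⇒<ᵇ≡true (≤-<-trans q≤q′ q′<len))))
    where
    q′<len : q′ < rowLength s
    q′<len = ≤-<-trans q′≤len (<ᵇ≡true⇒< drop)

  stepsBeyond-raise : ∀ {q q′} a m → q ≤ q′ → q′ ≤ rowLength (a + m) →
    stepsBeyond q′ a m ≡ stepsBeyond q a m
  stepsBeyond-raise {q} {q′} a m q≤q′ q′≤len = count-cong (stepBeyond q′) (stepBeyond q) (All-range a m raise)
    where
    raise : ∀ s → a ≤ s → s < a + m → stepBeyond q′ s ≡ stepBeyond q s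
    raise s a≤s s< = stepBeyond-raise s q≤q′ (≤-trans q′≤len (rowLength-antitone (s≤s z≤n) s<))

-- Part (i): a local partition into actual rectangles

between : ℕ → ℕ → ℕ → Bool
between lo hi x = (lo ≤ᵇ x) ∧ (x ≤ᵇ hi)

between-intro : ∀ {lo hi x} → lo ≤ x → x ≤ hi → between lo hi x ≡ true
between-intro lo≤x x≤hi = ∧-intro (≤⇒≤ᵇ≡true lo≤x) (≤⇒≤ᵇ≡true x≤hi)

between-elim : ∀ {lo hi x} → between lo hi x ≡ true → lo ≤ x × x ≤ hi
between-elim {lo} {hi} {x} h = let l , u = ∧-elim {lo ≤ᵇ x} h in ≤ᵇ≡true⇒≤ l , ≤ᵇ≡true⇒≤ u

between-consecutive : ∀ lo hi → Consecutive (between lo hi)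
between-consecutive lo hi x y z x≤y y≤z hx hz =
  between-intro (≤-trans (proj₁ (between-elim {lo} hx)) x≤y) (≤-trans y≤z (proj₂ (between-elim {lo} hz)))

rows-apart : ∀ {R R′} b → (∀ {s} → rows R s ≡ true → s < b) → (∀ {s} → rows R′ s ≡ true → b ≤ s) →
  Disjoint R R′
rows-apart b above below s t inR inR′ = <⇒≱ (above (proj₁ (∧-elim inR))) (below (proj₁ (∧-elim inR′)))

cols-apart : ∀ {R R′} b → (∀ {t} → cols R t ≡ true → t < b) → (∀ {t} → cols R′ t ≡ true → b ≤ t) →
  Disjoint R R′
cols-apart {R} {R′} b left right s t inR inR′ =
  <⇒≱ (left (proj₂ (∧-elim {rows R s} inR))) (right (proj₂ (∧-elim {rows R′ s} inR′)))

module Construction {r c : ℕ} {Y : ℕ → ℕ → Bool} (young : IsYoung r c Y) where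
  open IsYoung young using (inBox)
  open Young young

  record Tile (a n q : ℕ) (R : Rect) : Set where
    field
      actual       : IsActualRect R
      rows-within  : ∀ {s} → rows R s ≡ true → a ≤ s × s < a + n
      cols-within  : ∀ {t} → cols R t ≡ true → q < t × t ≤ rowLength a
      cells-inside : ∀ {s t} → rows R s ≡ true → cols R t ≡ true → t ≤ rowLength s
  open Tile

  Tile-weaken : ∀ {a n q a′ n′ q′ R} → a ≤ a′ → a′ + n′ ≤ a + n → q ≤ q′ →
    rowLength a′ ≤ rowLength a → Tile a′ n′ q′ R → Tile a n q R
  Tile-weaken a≤a′ end≤ q≤q′ len≤ tile = record
    { actual       = actual tile
    ; rows-within  = λ Rs → let a′≤s , s< = rows-within tile Rs in ≤-trans a≤a′ a′≤s , ≤-trans s< end≤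
    ; cols-within  = λ Rt → let q′<t , t≤ = cols-within tile Rt in ≤-<-trans q≤q′ q′<t , ≤-trans t≤ len≤
    ; cells-inside = cells-inside tile
    }

  record Tiling (i j a n q : ℕ) (P : List Rect) : Set where
    field
      tiles     : All (Tile a n q) P
      disjoint  : AllPairs Disjoint P
      covers    : ∀ {s t} → a ≤ s → s < a + n → q < t → t ≤ rowLength s → Any ((s , t) ∈R_) P
      row-local : ∀ s → rowUse P s ≤ i
      col-local : ∀ t → colUse P t ≤ j
  open Tiling

  empty-tiling : ∀ {i j a n q} → rowLength (a + n) ≤ q → stepsBeyond q a n ≡ 0 → Tiling i j a n q []
  empty-tiling {a = a} {n} {q} short none = record
    { tiles     = []
    ; disjoint  = []
    ; covers    = λ a≤s s< q<t t≤ →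
        ⊥-elim (<⇒≱ (<-≤-trans q<t t≤) (no-steps⇒short q a n none short a≤s (<⇒≤ s<)))
    ; row-local = λ _ → z≤n
    ; col-local = λ _ → z≤n
    }

  after-corner : ∀ a m rest → suc (a + m) + rest ≡ a + (m + suc rest)
  after-corner a m rest = trans (sym (+-suc (a + m) rest)) (+-assoc a m (suc rest))

  corner : ℕ → ℕ → ℕ → Rect
  corner a p q = between a p ⊠ between (suc q) (rowLength p)

  module Combine {i j a m rest q : ℕ} {T B : List Rect} (1≤a : 1 ≤ a) (q<len : q < rowLength (a + m))
    (top : Tiling i (suc j) a m (rowLength (a + m)) T) (bottom : Tiling (suc i) j (suc (a + m)) rest q B) where

    p n : ℕ
    p = a + m
    n = m + suc rest

    a≤p : a ≤ p
    a≤p = m≤m+n a m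

    end : suc p + rest ≡ a + n
    end = after-corner a m rest

    corner-tile : Tile a n q (corner a p q)
    corner-tile = record
      { actual       = between-consecutive a p , between-consecutive (suc q) (rowLength p)
      ; rows-within  = λ Rs → let a≤s , s≤p = between-elim Rs in
                         a≤s , ≤-<-trans s≤p (≤-trans (s≤s (m≤m+n p rest)) (≤-reflexive end))
      ; cols-within  = λ Rt → let q<t , t≤ = between-elim Rt in q<t , ≤-trans t≤ (rowLength-antitone 1≤a a≤p)
      ; cells-inside = λ Rs Rt → let a≤s , s≤p = between-elim Rs in
                         ≤-trans (proj₂ (between-elim Rt)) (rowLength-antitone (≤-trans 1≤a a≤s) s≤p)
      }

    all-tiles : All (Tile a n q) (corner a p q ∷ T ++ B)
    all-tiles = corner-tile ∷ All.++⁺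
      (All.map (Tile-weaken ≤-refl (+-monoʳ-≤ a (m≤m+n m (suc rest))) (<⇒≤ q<len) ≤-refl) (tiles top))
      (All.map (Tile-weaken a≤p+1 (≤-reflexive end) ≤-refl (rowLength-antitone 1≤a a≤p+1)) (tiles bottom))
      where
      a≤p+1 = m≤n⇒m≤1+n a≤p

    all-disjoint : AllPairs Disjoint (corner a p q ∷ T ++ B)
    all-disjoint =
      All.++⁺ (All.map corner-left-of (tiles top)) (All.map corner-above (tiles bottom)) ∷
      AllPairs.++⁺ (disjoint top) (disjoint bottom) (All.map (λ tile → All.map (top-above tile) (tiles bottom)) (tiles top))
      where
      corner-left-of : ∀ {R} → Tile a m (rowLength p) R → Disjoint (corner a p q) R
      corner-left-of tile = cols-apart {corner a p q} (suc (rowLength p))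
        (λ Ct → s≤s (proj₂ (between-elim {suc q} Ct))) (λ Rt → proj₁ (cols-within tile Rt))
      corner-above : ∀ {R} → Tile (suc p) rest q R → Disjoint (corner a p q) R
      corner-above tile = rows-apart {corner a p q} (suc p)
        (λ Cs → s≤s (proj₂ (between-elim {a} Cs))) (λ Rs → proj₁ (rows-within tile Rs))
      top-above : ∀ {R R′} → Tile a m (rowLength p) R → Tile (suc p) rest q R′ → Disjoint R R′
      top-above tile tile′ =
        rows-apart p (λ Rs → proj₂ (rows-within tile Rs)) (λ Rs → <⇒≤ (proj₁ (rows-within tile′ Rs)))

    covers-all : ∀ {s t} → a ≤ s → s < a + n → q < t → t ≤ rowLength s →
      Any ((s , t) ∈R_) (corner a p q ∷ T ++ B)
    covers-all {s} {t} a≤s s< q<t t≤ with s ≤? p | t ≤? rowLength p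
    ... | no s≰p  | _        = there (Any.++⁺ʳ T (covers bottom (≰⇒> s≰p) (≤-trans s< (≤-reflexive (sym end))) q<t t≤))
    ... | yes s≤p | yes t≤p  = here (∧-intro (between-intro a≤s s≤p) (between-intro q<t t≤p))
    ... | yes s≤p | no t≰p   = there (Any.++⁺ˡ (covers top a≤s s<p (≰⇒> t≰p) t≤))
      where
      s<p : s < p
      s<p with m≤n⇒m<n∨m≡n s≤p
      ... | inj₁ s<p  = s<p
      ... | inj₂ refl = ⊥-elim (t≰p t≤)

    row-local-all : ∀ s → rowUse (corner a p q ∷ T ++ B) s ≤ suc i
    row-local-all s = count-∷-≤ (λ R → rows R s) (corner a p q) (T ++ B) in-corner outside-corner
      where
      in-corner : between a p s ≡ true → rowUse (T ++ B) s ≤ i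
      in-corner Cs = ≤-trans (≤-reflexive (count-++-noneʳ (λ R → rows R s) T (All.map misses (tiles bottom))))
                             (row-local top s)
        where
        misses : ∀ {R} → Tile (suc p) rest q R → rows R s ≡ false
        misses tile = ¬true⇒false λ Rs → <⇒≱ (proj₁ (rows-within tile Rs)) (proj₂ (between-elim {a} Cs))
      outside-corner : between a p s ≡ false → rowUse (T ++ B) s ≤ suc i
      outside-corner ¬Cs = ≤-trans (≤-reflexive (count-++-noneˡ (λ R → rows R s) B (All.map misses (tiles top))))
                                   (row-local bottom s)
        where
        misses : ∀ {R} → Tile a m (rowLength p) R → rows R s ≡ false
        misses tile = ¬true⇒false λ Rs → let a≤s , s<p = rows-within tile Rs in
          true≢false (between-intro a≤s (<⇒≤ s<p)) ¬Cs

    col-local-all : ∀ t → colUse (corner a p q ∷ T ++ B) t ≤ suc j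
    col-local-all t = count-∷-≤ (λ R → cols R t) (corner a p q) (T ++ B) in-corner outside-corner
      where
      in-corner : between (suc q) (rowLength p) t ≡ true → colUse (T ++ B) t ≤ j
      in-corner Ct = ≤-trans (≤-reflexive (count-++-noneˡ (λ R → cols R t) B (All.map misses (tiles top))))
                             (col-local bottom t)
        where
        misses : ∀ {R} → Tile a m (rowLength p) R → cols R t ≡ false
        misses tile = ¬true⇒false λ Rt → <⇒≱ (proj₁ (cols-within tile Rt)) (proj₂ (between-elim {suc q} Ct))
      outside-corner : between (suc q) (rowLength p) t ≡ false → colUse (T ++ B) t ≤ suc j
      outside-corner ¬Ct = ≤-trans (≤-reflexive (count-++-noneʳ (λ R → cols R t) T (All.map misses (tiles bottom))))
                                   (col-local top t)
        where
        misses : ∀ {R} → Tile (suc p) rest q R → cols R t ≡ false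
        misses tile = ¬true⇒false λ Rt → let q<t , t≤ = cols-within tile Rt in
          true≢false (between-intro q<t (≤-trans t≤ (rowLength-antitone (≤-trans 1≤a a≤p) (n≤1+n p)))) ¬Ct

    combined : Tiling (suc i) (suc j) a n q (corner a p q ∷ T ++ B)
    combined = record
      { tiles     = all-tiles
      ; disjoint  = all-disjoint
      ; covers    = covers-all
      ; row-local = row-local-all
      ; col-local = col-local-all
      }

  tiling : ∀ i j a n q → 1 ≤ a → rowLength (a + n) ≤ q → stepsBeyond q a n ≤ maxSteps i j →
    ∃ (Tiling i j a n q)
  tiling i j a n q 1≤a short few with stepsBeyond q a n in steps
  ... | zero = [] , empty-tiling short steps
  tiling zero    j       a n q 1≤a short () | suc z
  tiling (suc i) zero    a n q 1≤a short () | suc z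
  tiling (suc i) (suc j) a n q 1≤a short few | suc z =
    split-at (kth-step q a n (F₁ ⊓ z) (subst (F₁ ⊓ z <_) (sym steps) (s≤s (m⊓n≤n F₁ z))))
    where
    F₁ = maxSteps i (suc j)
    split-at : (∃ λ m → m < n × stepBeyond q (a + m) ≡ true × stepsBeyond q a m ≡ F₁ ⊓ z) →
      ∃ (Tiling (suc i) (suc j) a n q)
    split-at (m , m<n , step , above) =
      subst (λ n → ∃ (Tiling (suc i) (suc j) a n q)) n≡ (_ , Combine.combined 1≤a q<len (proj₂ top) (proj₂ bottom))
      where
      rest = n ∸ suc m
      n≡ : m + suc rest ≡ n
      n≡ = trans (+-suc m rest) (m+[n∸m]≡n m<n)
      q<len : q < rowLength (a + m)
      q<len = proj₁ (stepBeyond-elim step)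
      below : stepsBeyond q (suc (a + m)) rest ≡ z ∸ F₁
      below = +-cancelˡ-≡ (F₁ ⊓ z) _ _ (suc-injective (begin
        suc (F₁ ⊓ z + stepsBeyond q (suc (a + m)) rest)              ≡⟨ +-suc (F₁ ⊓ z) _ ⟨
        F₁ ⊓ z + suc (stepsBeyond q (suc (a + m)) rest)              ≡⟨ cong (_+ _) above ⟨
        stepsBeyond q a m + suc (stepsBeyond q (suc (a + m)) rest)  ≡⟨ stepsBeyond-around q a m rest step ⟨
        stepsBeyond q a (m + suc rest)                              ≡⟨ trans (cong (stepsBeyond q a) n≡) steps ⟩
        suc z                                                       ≡⟨ cong suc (m⊓n+n∸m≡n F₁ z) ⟨
        suc (F₁ ⊓ z + (z ∸ F₁))                                     ∎))
        where open ≡-Reasoning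
      top = tiling i (suc j) a m (rowLength (a + m)) 1≤a ≤-refl
        (≤-trans (≤-reflexive (trans (stepsBeyond-raise a m (<⇒≤ q<len) ≤-refl) above)) (m⊓n≤m F₁ z))
      bottom = tiling (suc i) j (suc (a + m)) rest q (s≤s z≤n)
        (subst (λ x → rowLength x ≤ q) (sym (trans (after-corner a m rest) (cong (a +_) n≡))) short)
        (≤-trans (≤-reflexive below) (m≤n+o⇒m∸n≤o z F₁ (≤-pred few)))

  tile⇒genRect : ∀ {R} → Tile 1 r 0 R → IsGenRect r c Y R
  tile⇒genRect tile =
    (λ s Rs → let 1≤s , s≤r = rows-within tile Rs in 1≤s , ≤-pred s≤r) ,
    (λ t Rt → let 0<t , t≤ = cols-within tile Rt in 0<t , ≤-trans t≤ (rowLength≤c 1)) ,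
    (λ s t R-st → let Rs , Rt = ∧-elim R-st in
       ≤rowLength⇒cell (proj₁ (cols-within tile Rt)) (cells-inside tile Rs Rt))

  local-partition : ∀ i j → numSteps r c Y ≤ maxSteps i j →
    ∃ λ P → IsPartition r c Y P × All IsActualRect P × IsLocal i j P
  local-partition i j few with tiling i j 1 r 0 ≤-refl (≤-reflexive (rowLength-beyond ≤-refl))
                                 (subst (_≤ maxSteps i j) numSteps≡count-stepBeyond few)
  ... | P , tiled = P , ((All.map tile⇒genRect (tiles tiled) , covers-Y) , disjoint tiled) ,
                    All.map actual (tiles tiled) , row-local tiled , col-local tiled
    where
    covers-Y : ∀ s t → Y s t ≡ true → Any ((s , t) ∈R_) P
    covers-Y s t Yst = let (1≤s , s≤r) , _ = inBox s t Yst ; 1≤t , t≤len = cell⇒≤rowLength Yst in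
                       covers tiled 1≤s (s≤s s≤r) 1≤t t≤len

-- Part (ii): the staircase spanned by the steps

-- Staircase row k < Z is the row of the step with k steps above it and staircase column t + 1 is the
-- last column of staircase row t; other indices go to the empty row r + 1 and to column 0.
module Embedding {r c : ℕ} {Y : ℕ → ℕ → Bool} (young : IsYoung r c Y) where
  open Young young

  Z : ℕ
  Z = stepsBeyond 0 1 r

  stepRowFrom : ∀ k → Dec (k < Z) → ℕ
  stepRowFrom k (yes k<Z) = suc (proj₁ (kth-step 0 1 r k k<Z))
  stepRowFrom k (no _)    = suc r

  stepRow : ℕ → ℕ
  stepRow k = stepRowFrom k (k <? Z)

  stepRow-spec : ∀ {k} → k < Z →
    ∃ λ m → stepRow k ≡ suc m × stepBeyond 0 (suc m) ≡ true × stepsBeyond 0 1 m ≡ k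
  stepRow-spec {k} k<Z with k <? Z
  ... | yes k<Z′ = let m , _ , step , rank = kth-step 0 1 r k k<Z′ in m , refl , step , rank
  ... | no k≮Z   = ⊥-elim (k≮Z k<Z)

  stepRow-outside : ∀ k → stepRow k ≡ suc r ⊎ k < Z
  stepRow-outside k with k <? Z
  ... | yes k<Z = inj₂ k<Z
  ... | no _    = inj₁ refl

  stepRow-< : ∀ {k k′} → k < k′ → k′ < Z → stepRow k < stepRow k′
  stepRow-< {k} {k′} k<k′ k′<Z with stepRow-spec (<-trans k<k′ k′<Z) | stepRow-spec k′<Z
  ... | m , row , _ , rank | m′ , row′ , _ , rank′ rewrite row | row′ =
    s≤s (≰⇒> λ m′≤m → <⇒≱ k<k′ (subst₂ _≤_ rank′ rank (stepsBeyond-mono 0 1 m′≤m)))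

  stepLength : ℕ → ℕ
  stepLength k = rowLength (stepRow k)

  stepLength-pos : ∀ {k} → k < Z → 0 < stepLength k
  stepLength-pos k<Z with stepRow-spec k<Z
  ... | m , row , step , _ = subst (λ x → 0 < rowLength x) (sym row) (proj₁ (stepBeyond-elim step))

  stepLength-< : ∀ {k k′} → k < k′ → k′ < Z → stepLength k′ < stepLength k
  stepLength-< {k} {k′} k<k′ k′<Z with stepRow-spec (<-trans k<k′ k′<Z)
  ... | m , row , step , _ = ≤-<-trans
    (rowLength-antitone (s≤s z≤n) (subst (_< stepRow k′) row (stepRow-< k<k′ k′<Z)))
    (subst (λ x → rowLength (suc (suc m)) < rowLength x) (sym row) (proj₂ (stepBeyond-elim step)))

  stepLength-antitone : ∀ {k k′} → k ≤ k′ → k′ < Z → stepLength k′ ≤ stepLength k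
  stepLength-antitone k≤k′ k′<Z with m≤n⇒m<n∨m≡n k≤k′
  ... | inj₁ k<k′ = <⇒≤ (stepLength-< k<k′ k′<Z)
  ... | inj₂ refl = ≤-refl

  stepLength-pos⇒< : ∀ {k} → 0 < stepLength k → k < Z
  stepLength-pos⇒< {k} pos with stepRow-outside k
  ... | inj₂ k<Z = k<Z
  ... | inj₁ row = ⊥-elim (<⇒≱ pos (≤-reflexive (trans (cong rowLength row) (rowLength-beyond ≤-refl))))

  column : ℕ → ℕ
  column zero    = 0
  column (suc t) = stepLength t

  cell⇒above-diagonal : ∀ s t → Y (stepRow s) (column t) ≡ true → s < t
  cell⇒above-diagonal s zero    cell = ⊥-elim (<⇒≱ (proj₁ (cell⇒≤rowLength cell)) z≤n)
  cell⇒above-diagonal s (suc t) cell with cell⇒≤rowLength cell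
  ... | 0<len , len≤ =
    s≤s (≮⇒≥ λ t<s → <⇒≱ (stepLength-< t<s (stepLength-pos⇒< (<-≤-trans 0<len len≤))) len≤)

  below-diagonal⇒cell : ∀ {s t} → s < t → t ≤ Z → Y (stepRow s) (column t) ≡ true
  below-diagonal⇒cell {s} {suc t} (s≤s s≤t) t<Z = ≤rowLength⇒cell (stepLength-pos t<Z) (stepLength-antitone s≤t t<Z)

  no-local-cover : ∀ i j → maxSteps i j < numSteps r c Y → ¬ (∃ λ C → IsCover r c Y C × IsLocal i j C)
  no-local-cover i j many (C , (inside , covers-Y) , row-local-C , col-local-C) =
    <⇒≱ (subst (maxSteps i j <_) numSteps≡count-stepBeyond many) (≤-pred (staircase-bound i j 0 (suc Z) cover))
    where
    above : All (λ R → ∀ s t → (rows R (stepRow s) ∧ cols R (column t)) ≡ true → s < t) C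
    above = All.map (λ genRect s t R-st → cell⇒above-diagonal s t (proj₂ (proj₂ genRect) _ _ R-st)) inside
    open Staircase C stepRow column above
    cover : LocalCover i j 0 (suc Z)
    cover = record
      { covers    = λ s t _ s<t t< → covers-Y (stepRow s) (column t) (below-diagonal⇒cell s<t (≤-pred t<))
      ; row-local = λ s _ _ → ≤-trans
          (count-mono (rowMeets 0 (suc Z) s) (λ R → usesRow R s) (λ R → proj₁ ∘ ∧-elim) C) (row-local-C (stepRow s))
      ; col-local = λ t _ _ → ≤-trans
          (count-mono (colMeets 0 (suc Z) t) (λ R → usesCol R t) (λ R → proj₁ ∘ ∧-elim) C) (col-local-C (column t))
      }

theorem3 : (i j z : ℕ) → 1 ≤ i → 1 ≤ j → 1 ≤ z →
    (r c : ℕ) (Y : ℕ → ℕ → Bool) → IsYoung r c Y → numSteps r c Y ≡ z →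
    (z < (i + j) C i →
      ∃ λ (P : List Rect) → IsPartition r c Y P × All IsActualRect P × IsLocal i j P) ×
    ((i + j) C i ≤ z →
      ¬ (∃ λ (C : List Rect) → IsCover r c Y C × IsLocal i j C))
theorem3 i j z _ _ _ r c Y young steps = partition , no-cover
  where
  binom≡ : (i + j) C i ≡ suc (maxSteps i j)
  binom≡ = sym (suc-maxSteps i j)
  partition : z < (i + j) C i → ∃ λ P → IsPartition r c Y P × All IsActualRect P × IsLocal i j P
  partition z<binom = Construction.local-partition young i j (≤-pred (subst₂ _<_ (sym steps) binom≡ z<binom))
  no-cover : (i + j) C i ≤ z → ¬ (∃ λ C → IsCover r c Y C × IsLocal i j C)
  no-cover binom≤z = Embedding.no-local-cover young i j (subst₂ _≤_ binom≡ (sym steps) binom≤z)
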